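{- Let $z,c\in\mathbb{Z}[t]$ be such that $z^2+c$ has odd leading coefficient. If $\frac{d}{dt}(\bar c)=1$ in $\mathbb{F}_2[t]$, then $z^2+c$ is square-free in $\mathbb{Q}[t]$.
   Context: $\bar c\in\mathbb{F}_2[t]$ denotes the reduction of the coefficients of $c$ modulo $2$; $\frac{d}{dt}$ is the usual formal derivative. -}

module Defs where

open import Data.Nat as ℕ using (ℕ; zero; suc; _<_; _≥_)
open import Data.Integer as ℤ using (ℤ)
open import Data.Integer.Divisibility using () renaming (_∣_ to _∣ℤ_)
open import Data.Rational as ℚ using (ℚ)
open import Data.Bool using (Bool; true; false; _xor_; _∧_)
open import Data.List using (List; []; _∷_; map)
open import Data.Product using (Σ; _×_; ∃)
open import Relation.Binary.PropositionalEquality using (_≡_; _≢_)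
open import Relation.Nullary using (¬_)

-- Univariate polynomials over a commutative (semi)ring with propositional
-- equality, represented by coefficient lists (constant term first).
-- Trailing zeros are allowed; polynomial equality is coefficientwise.
module PolyOps {A : Set} (0# 1# : A) (_+_ _*_ : A → A → A) where

  Poly : Set
  Poly = List A

  coeff : Poly → ℕ → A
  coeff []       _       = 0#
  coeff (a ∷ p)  zero    = a
  coeff (a ∷ p)  (suc k) = coeff p k

  _≈_ : Poly → Poly → Set
  p ≈ q = ∀ k → coeff p k ≡ coeff q k

  add : Poly → Poly → Poly
  add []      q       = q
  add p       []      = p
  add (a ∷ p) (b ∷ q) = (a + b) ∷ add p q

  mul : Poly → Poly → Poly
  mul []      q = []
  mul (a ∷ p) q = add (map (a *_) q) (0# ∷ mul p q)

  nsmul : ℕ → A → A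
  nsmul zero    a = 0#
  nsmul (suc n) a = a + nsmul n a

  -- formal derivative: coefficient k of p' is (k+1)·p_{k+1}
  derivAux : ℕ → Poly → Poly
  derivAux n []      = []
  derivAux n (a ∷ p) = nsmul n a ∷ derivAux (suc n) p

  deriv : Poly → Poly
  deriv []      = []
  deriv (a ∷ p) = derivAux 1 p

  one : Poly
  one = 1# ∷ []

  IsLeadingCoeff : Poly → A → Set
  IsLeadingCoeff f a =
    Σ ℕ λ n → (coeff f n ≡ a) × (a ≢ 0#) × (∀ m → n < m → coeff f m ≡ 0#)

  NonConstant : Poly → Set
  NonConstant g = Σ ℕ λ k → (k ≥ 1) × (coeff g k ≢ 0#)

  SquareFree : Poly → Set
  SquareFree f = ¬ (Σ Poly λ g → Σ Poly λ h → NonConstant g × (f ≈ mul (mul g g) h))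

module ℤ[t] = PolyOps (ℤ.+ 0) (ℤ.+ 1) ℤ._+_ ℤ._*_
module ℚ[t] = PolyOps ℚ.0ℚ ℚ.1ℚ ℚ._+_ ℚ._*_
module 𝔽₂[t] = PolyOps false true _xor_ _∧_

red2 : ℤ → Bool
red2 a = (ℤ.∣ a ∣ ℕ.% 2) ℕ.≡ᵇ 1

bar : ℤ[t].Poly → 𝔽₂[t].Poly
bar = map red2

toℚ[t] : ℤ[t].Poly → ℚ[t].Poly
toℚ[t] = map (λ a → a ℚ./ 1)

Odd : ℤ → Set
Odd a = ¬ (ℤ.+ 2 ∣ℤ a)

module Submission where

-- Suppose z² + c = g²h in ℚ[t] with g non-constant. Clearing denominators gives N(z² + c) = G²H in
-- ℤ[t] with N ≠ 0, and since 𝔽₂[t] is a domain, a factor 2 of N can always be absorbed into G or H,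
-- so we may take N odd. Reducing mod 2 then gives f̄ = Ḡ²H̄ for f = z² + c. Differentiation kills
-- squares in characteristic 2, so 1 = c̄′ = f̄′ = Ḡ²H̄′, which forces Ḡ to be constant. Hence the
-- leading coefficient of G, and with it that of G²H, is even, while that of N·f is N·a, odd.

open import Defs
open import Level using (0ℓ)
open import Algebra.Bundles using (CommutativeMonoid; CommutativeRing)
open import Algebra.Structures using (IsCommutativeSemiring; IsCommutativeRing)
open import Data.Bool as Bool using (Bool; true; false; not; _xor_; _∧_)
open import Data.Bool.Properties
  using (xor-∧-commutativeRing; xor-same; xor-comm; xor-identityʳ; xor-annihilates-not; not-involutive; not-distribˡ-xor)
open import Data.Empty using (⊥; ⊥-elim)
open import Data.Integer as ℤ using (ℤ; +_; -[1+_])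
import Data.Integer.Properties as ℤₚ
open import Data.Integer.Divisibility using () renaming (_∣_ to _∣ℤ_)
open import Data.Integer.Divisibility.Signed using (divides; ∣ᵤ⇒∣)
open import Data.Integer.Tactic.RingSolver using (solve-∀)
open import Data.List using ([]; _∷_; map)
open import Data.Nat as ℕ using (ℕ; zero; suc; _<_; _≤_; z≤n; s≤s)
import Data.Nat.Properties as ℕₚ
open import Data.Nat.DivMod using (_%_; m%n<n; [m+n]%n≡m%n)
open import Data.Nat.Divisibility using (m%n≡0⇒n∣m)
open import Data.Product using (Σ; _×_; _,_; proj₁; proj₂; ∃; ∃₂)
open import Data.Rational as ℚ using (ℚ; mkℚ; ↥_; ↧_)
import Data.Rational.Properties as ℚₚ
open import Data.Rational.Unnormalised as ℚᵘ using (mkℚᵘ; *≡*)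
import Data.Rational.Unnormalised.Properties as ℚᵘₚ
open import Data.Sum as Sum using (_⊎_; inj₁; inj₂; [_,_]′)
open import Function using (_∘_; const; id)
open import Relation.Binary.Definitions using (tri<; tri≈; tri>)
open import Relation.Binary.PropositionalEquality
open import Relation.Nullary using (Dec; yes; no; ¬_; contradiction)

module PolyProperties {A : Set} {0# 1# : A} {+ᴬ *ᴬ : A → A → A}
  (isCommutativeSemiring : IsCommutativeSemiring _≡_ +ᴬ *ᴬ 0# 1#) where

  -- module parameters cannot be given a fixity, so the operators are local aliases
  infixl 6 _+_
  infixl 7 _*_
  _+_ _*_ : A → A → A
  _+_ = +ᴬ
  _*_ = *ᴬ

  open IsCommutativeSemiring isCommutativeSemiring
    using ( +-comm; +-identityˡ; +-identityʳ; +-isCommutativeMonoid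
          ; *-assoc; *-comm; distribˡ; distribʳ; zeroˡ; zeroʳ )
  open PolyOps 0# 1# _+_ _*_

  private
    +-commutativeMonoid : CommutativeMonoid 0ℓ 0ℓ
    +-commutativeMonoid = record { isCommutativeMonoid = +-isCommutativeMonoid }

  open import Algebra.Properties.CommutativeSemigroup
    (CommutativeMonoid.commutativeSemigroup +-commutativeMonoid) using (interchange; x∙yz≈y∙xz)
  open import Algebra.Solver.CommutativeMonoid +-commutativeMonoid using (solve; _⊕_; _⊜_)
  open import Relation.Binary.Reasoning.Setoid (ℕ →-setoid A)

  shift : (ℕ → A) → ℕ → A
  shift f i = f (suc i)

  VanishesAbove : (ℕ → A) → ℕ → Set
  VanishesAbove f m = ∀ i → m < i → f i ≡ 0#

  -- the Cauchy product, with the recursion of PolyOps.mul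
  infixl 7 _⊛_
  _⊛_ : (ℕ → A) → (ℕ → A) → ℕ → A
  (f ⊛ g) zero    = f 0 * g 0
  (f ⊛ g) (suc k) = f 0 * g (suc k) + (shift f ⊛ g) k

  ⊛-cong : ∀ {f f′ g g′} → f ≗ f′ → g ≗ g′ → f ⊛ g ≗ f′ ⊛ g′
  ⊛-cong f≗f′ g≗g′ zero    = cong₂ _*_ (f≗f′ 0) (g≗g′ 0)
  ⊛-cong f≗f′ g≗g′ (suc k) =
    cong₂ _+_ (cong₂ _*_ (f≗f′ 0) (g≗g′ (suc k))) (⊛-cong (f≗f′ ∘ suc) g≗g′ k)

  ⊛-zeroˡ : ∀ f g → f ≗ const 0# → f ⊛ g ≗ const 0#
  ⊛-zeroˡ f g f≗0 zero    = trans (cong (_* g 0) (f≗0 0)) (zeroˡ (g 0))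
  ⊛-zeroˡ f g f≗0 (suc k) =
    trans (cong₂ _+_ (trans (cong (_* g (suc k)) (f≗0 0)) (zeroˡ _)) (⊛-zeroˡ (shift f) g (f≗0 ∘ suc) k))
          (+-identityˡ 0#)

  ⊛-scaleˡ : ∀ c f g → (λ i → c * f i) ⊛ g ≗ λ k → c * (f ⊛ g) k
  ⊛-scaleˡ c f g zero    = *-assoc c (f 0) (g 0)
  ⊛-scaleˡ c f g (suc k) =
    trans (cong₂ _+_ (*-assoc c (f 0) (g (suc k))) (⊛-scaleˡ c (shift f) g k)) (sym (distribˡ c _ _))

  ⊛-distribʳ : ∀ f f′ g → (λ i → f i + f′ i) ⊛ g ≗ λ k → (f ⊛ g) k + (f′ ⊛ g) k
  ⊛-distribʳ f f′ g zero    = distribʳ (g 0) (f 0) (f′ 0)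
  ⊛-distribʳ f f′ g (suc k) =
    trans (cong₂ _+_ (distribʳ (g (suc k)) (f 0) (f′ 0)) (⊛-distribʳ (shift f) (shift f′) g k))
          (interchange _ _ _ _)

  ⊛-suc : ∀ f g k → (f ⊛ g) (suc k) ≡ f (suc k) * g 0 + (f ⊛ shift g) k
  ⊛-suc f g zero    = +-comm _ _
  ⊛-suc f g (suc k) = trans (cong (λ y → f 0 * g (suc (suc k)) + y) (⊛-suc (shift f) g k)) (x∙yz≈y∙xz _ _ _)

  ⊛-comm : ∀ f g → f ⊛ g ≗ g ⊛ f
  ⊛-comm f g zero    = *-comm (f 0) (g 0)
  ⊛-comm f g (suc k) =
    trans (cong₂ _+_ (*-comm (f 0) (g (suc k))) (⊛-comm (shift f) g k)) (sym (⊛-suc g f k))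

  ⊛-scaleʳ : ∀ c f g → f ⊛ (λ i → c * g i) ≗ λ k → c * (f ⊛ g) k
  ⊛-scaleʳ c f g k =
    trans (⊛-comm f (λ i → c * g i) k) (trans (⊛-scaleˡ c g f k) (cong (c *_) (⊛-comm g f k)))

  ⊛-shiftˡ : ∀ f g → f 0 ≡ 0# → ∀ k → (f ⊛ g) (suc k) ≡ (shift f ⊛ g) k
  ⊛-shiftˡ f g f0≡0 k =
    trans (cong (λ x → x * g (suc k) + rest) f0≡0) (trans (cong (_+ rest) (zeroˡ _)) (+-identityˡ rest))
    where rest = (shift f ⊛ g) k

  ⊛-shiftʳ : ∀ f g → g 0 ≡ 0# → ∀ k → (f ⊛ g) (suc k) ≡ (f ⊛ shift g) k
  ⊛-shiftʳ f g g0≡0 k =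
    trans (⊛-suc f g k)
          (trans (cong (λ x → f (suc k) * x + rest) g0≡0) (trans (cong (_+ rest) (zeroʳ _)) (+-identityˡ rest)))
    where rest = (f ⊛ shift g) k

  ⊛-top : ∀ f g m n → VanishesAbove f m → VanishesAbove g n →
          (f ⊛ g) (m ℕ.+ n) ≡ f m * g n × VanishesAbove (f ⊛ g) (m ℕ.+ n)
  ⊛-top f g zero n f>0 g>n =
    ⊛-const n , λ k n<k → trans (⊛-const k) (trans (cong (f 0 *_) (g>n k n<k)) (zeroʳ _))
    where
    ⊛-const : ∀ k → (f ⊛ g) k ≡ f 0 * g k
    ⊛-const zero    = refl
    ⊛-const (suc k) =
      trans (cong (λ y → f 0 * g (suc k) + y) (⊛-zeroˡ (shift f) g (λ i → f>0 (suc i) (s≤s z≤n)) k))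
            (+-identityʳ _)
  ⊛-top f g (suc m) n f>m g>n =
      trans (drop-head (m ℕ.+ n) (ℕₚ.m≤n+m n m)) (proj₁ top)
    , λ { (suc k) (s≤s m+n<k) →
            trans (drop-head k (ℕₚ.≤-trans (ℕₚ.m≤n+m n m) (ℕₚ.<⇒≤ m+n<k))) (proj₂ top k m+n<k) }
    where
    top = ⊛-top (shift f) g m n (λ i m<i → f>m (suc i) (s≤s m<i)) g>n
    drop-head : ∀ k → n ≤ k → f 0 * g (suc k) + (shift f ⊛ g) k ≡ (shift f ⊛ g) k
    drop-head k n≤k =
      trans (cong (_+ (shift f ⊛ g) k) (trans (cong (f 0 *_) (g>n (suc k) (s≤s n≤k))) (zeroʳ _))) (+-identityˡ _)

  nsmul-+ : ∀ n x y → nsmul n (x + y) ≡ nsmul n x + nsmul n y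
  nsmul-+ zero    x y = sym (+-identityˡ 0#)
  nsmul-+ (suc n) x y = trans (cong (λ z → x + y + z) (nsmul-+ n x y)) (interchange x y _ _)

  nsmul-* : ∀ n c x → nsmul n (c * x) ≡ c * nsmul n x
  nsmul-* zero    c x = sym (zeroʳ c)
  nsmul-* (suc n) c x = trans (cong (λ y → c * x + y) (nsmul-* n c x)) (sym (distribˡ c _ _))

  nsmul-zero : ∀ n → nsmul n 0# ≡ 0#
  nsmul-zero zero    = refl
  nsmul-zero (suc n) = trans (cong (λ y → 0# + y) (nsmul-zero n)) (+-identityˡ 0#)

  -- t·d/dt, which unlike d/dt acts on coefficient sequences without an index shift
  euler : (ℕ → A) → ℕ → A
  euler f k = nsmul k (f k)

  euler-⊛ : ∀ f g → euler (f ⊛ g) ≗ λ k → (euler f ⊛ g) k + (f ⊛ euler g) k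
  euler-⊛ f g zero    = sym (trans (cong₂ _+_ (zeroˡ _) (zeroʳ _)) (+-identityˡ 0#))
  euler-⊛ f g (suc k) = ≡.begin
      (a + B) + nsmul k (a + B)
    ≡.≡⟨ cong (λ y → a + B + y)
              (trans (nsmul-+ k a B) (cong₂ _+_ (nsmul-* k (f 0) x) (euler-⊛ (shift f) g k))) ⟩
      (a + B) + (f 0 * nsmul k x + (C + D))
    ≡.≡⟨ solve 5 (λ a B e C D → (a ⊕ B) ⊕ (e ⊕ (C ⊕ D)) ⊜ (B ⊕ C) ⊕ ((a ⊕ e) ⊕ D)) refl a B _ C D ⟩
      (B + C) + ((a + f 0 * nsmul k x) + D)
    ≡.≡⟨ cong₂ _+_ (sym (trans (cong₂ _+_ (zeroˡ x) (⊛-distribʳ (shift f) (euler (shift f)) g k)) (+-identityˡ _)))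
                   (cong (_+ D) (sym (distribˡ (f 0) x (nsmul k x)))) ⟩
      (euler f ⊛ g) (suc k) + (f ⊛ euler g) (suc k)
    ≡.∎
    where
    module ≡ = ≡-Reasoning
    x = g (suc k)
    a = f 0 * x
    B = (shift f ⊛ g) k
    C = (euler (shift f) ⊛ g) k
    D = (shift f ⊛ euler g) k

  scale : A → Poly → Poly
  scale a = map (a *_)

  coeff-add : ∀ p q → coeff (add p q) ≗ λ k → coeff p k + coeff q k
  coeff-add []      q       k       = sym (+-identityˡ _)
  coeff-add (a ∷ p) []      k       = sym (+-identityʳ _)
  coeff-add (a ∷ p) (b ∷ q) zero    = refl
  coeff-add (a ∷ p) (b ∷ q) (suc k) = coeff-add p q k

  coeff-scale : ∀ a p → coeff (scale a p) ≗ λ k → a * coeff p k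
  coeff-scale a []      k       = sym (zeroʳ a)
  coeff-scale a (b ∷ p) zero    = refl
  coeff-scale a (b ∷ p) (suc k) = coeff-scale a p k

  coeff-mul : ∀ p q → coeff (mul p q) ≗ coeff p ⊛ coeff q
  coeff-mul []      q k       = sym (⊛-zeroˡ (coeff []) (coeff q) (λ _ → refl) k)
  coeff-mul (a ∷ p) q zero    =
    trans (coeff-add (scale a q) (0# ∷ mul p q) 0) (trans (+-identityʳ _) (coeff-scale a q 0))
  coeff-mul (a ∷ p) q (suc k) =
    trans (coeff-add (scale a q) (0# ∷ mul p q) (suc k)) (cong₂ _+_ (coeff-scale a q (suc k)) (coeff-mul p q k))

  coeff-derivAux : ∀ n p k → coeff (derivAux n p) k ≡ nsmul (n ℕ.+ k) (coeff p k)
  coeff-derivAux n []      k       = sym (nsmul-zero (n ℕ.+ k))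
  coeff-derivAux n (a ∷ p) zero    = cong (λ m → nsmul m a) (sym (ℕₚ.+-identityʳ n))
  coeff-derivAux n (a ∷ p) (suc k) =
    trans (coeff-derivAux (suc n) p k) (cong (λ m → nsmul m (coeff p k)) (sym (ℕₚ.+-suc n k)))

  coeff-deriv : ∀ p → coeff (deriv p) ≗ shift (euler (coeff p))
  coeff-deriv []      k = sym (nsmul-zero (suc k))
  coeff-deriv (a ∷ p) k = coeff-derivAux 1 p k

  coeff-mul-mul : ∀ p q r → coeff (mul (mul p q) r) ≗ (coeff p ⊛ coeff q) ⊛ coeff r
  coeff-mul-mul p q r k = trans (coeff-mul (mul p q) r k) (⊛-cong (coeff-mul p q) (λ _ → refl) k)

  -- polynomial arguments are explicit: _≈_ unfolds to equations between coeff-terms, which do not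
  -- determine the polynomials by unification
  add-congˡ : ∀ p p′ q → p ≈ p′ → add p q ≈ add p′ q
  add-congˡ p p′ q p≈p′ k =
    trans (coeff-add p q k) (trans (cong (_+ coeff q k) (p≈p′ k)) (sym (coeff-add p′ q k)))

  scale-cong : ∀ a p q → p ≈ q → scale a p ≈ scale a q
  scale-cong a p q p≈q k = trans (coeff-scale a p k) (trans (cong (a *_) (p≈q k)) (sym (coeff-scale a q k)))

  square-mul-cong : ∀ g g′ h h′ → g ≈ g′ → h ≈ h′ → mul (mul g g) h ≈ mul (mul g′ g′) h′
  square-mul-cong g g′ h h′ g≈g′ h≈h′ k =
    trans (coeff-mul-mul g g h k) (trans (⊛-cong (⊛-cong g≈g′ g≈g′) h≈h′ k) (sym (coeff-mul-mul g′ g′ h′ k)))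

  deriv-cong : ∀ p q → p ≈ q → deriv p ≈ deriv q
  deriv-cong p q p≈q k =
    trans (coeff-deriv p k) (trans (cong (nsmul (suc k)) (p≈q (suc k))) (sym (coeff-deriv q k)))

  mul-comm : ∀ p q → mul p q ≈ mul q p
  mul-comm p q k = trans (coeff-mul p q k) (trans (⊛-comm (coeff p) (coeff q) k) (sym (coeff-mul q p k)))

  mul-≈[]ʳ : ∀ p q → q ≈ [] → mul p q ≈ []
  mul-≈[]ʳ p q q≈[] k = trans (mul-comm p q k) (trans (coeff-mul q p k) (⊛-zeroˡ (coeff q) (coeff p) q≈[] k))

  scale-mulʳ : ∀ a p q → mul p (scale a q) ≈ scale a (mul p q)
  scale-mulʳ a p q = begin
    coeff (mul p (scale a q))           ≈⟨ coeff-mul p (scale a q) ⟩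
    coeff p ⊛ coeff (scale a q)         ≈⟨ ⊛-cong (λ _ → refl) (coeff-scale a q) ⟩
    coeff p ⊛ (λ i → a * coeff q i)     ≈⟨ ⊛-scaleʳ a (coeff p) (coeff q) ⟩
    (λ k → a * (coeff p ⊛ coeff q) k)   ≈⟨ cong (a *_) ∘ coeff-mul p q ⟨
    (λ k → a * coeff (mul p q) k)       ≈⟨ coeff-scale a (mul p q) ⟨
    coeff (scale a (mul p q))           ∎

  scale-scale : ∀ a b p → scale a (scale b p) ≈ scale (a * b) p
  scale-scale a b p k =
    trans (coeff-scale a (scale b p) k)
          (trans (cong (a *_) (coeff-scale b p k)) (trans (sym (*-assoc a b _)) (sym (coeff-scale (a * b) p k))))

  square-scale : ∀ a g h → mul (mul (scale a g) (scale a g)) h ≈ scale (a * a) (mul (mul g g) h)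
  square-scale a g h = begin
    coeff (mul (mul (scale a g) (scale a g)) h)
      ≈⟨ coeff-mul-mul (scale a g) (scale a g) h ⟩
    (coeff (scale a g) ⊛ coeff (scale a g)) ⊛ H
      ≈⟨ ⊛-cong (⊛-cong (coeff-scale a g) (coeff-scale a g)) (λ _ → refl) ⟩
    (aG ⊛ aG) ⊛ H
      ≈⟨ ⊛-cong (λ k → trans (⊛-scaleˡ a G aG k) (trans (cong (a *_) (⊛-scaleʳ a G G k)) (sym (*-assoc a a _))))
                (λ _ → refl) ⟩
    (λ k → (a * a) * (G ⊛ G) k) ⊛ H
      ≈⟨ ⊛-scaleˡ (a * a) (G ⊛ G) H ⟩
    (λ k → (a * a) * ((G ⊛ G) ⊛ H) k)
      ≈⟨ cong ((a * a) *_) ∘ coeff-mul-mul g g h ⟨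
    (λ k → (a * a) * coeff (mul (mul g g) h) k)
      ≈⟨ coeff-scale (a * a) (mul (mul g g) h) ⟨
    coeff (scale (a * a) (mul (mul g g) h))
      ∎
    where
    G = coeff g
    H = coeff h
    aG = λ i → a * G i

  deriv-add : ∀ p q → deriv (add p q) ≈ add (deriv p) (deriv q)
  deriv-add p q k =
    trans (coeff-deriv (add p q) k)
          (trans (cong (nsmul (suc k)) (coeff-add p q (suc k)))
                 (trans (nsmul-+ (suc k) _ _)
                        (sym (trans (coeff-add (deriv p) (deriv q) k)
                                    (cong₂ _+_ (coeff-deriv p k) (coeff-deriv q k))))))

  deriv-mul : ∀ p q → deriv (mul p q) ≈ add (mul (deriv p) q) (mul p (deriv q))
  deriv-mul p q = begin
    coeff (deriv (mul p q))
      ≈⟨ coeff-deriv (mul p q) ⟩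
    shift (euler (coeff (mul p q)))
      ≈⟨ (λ k → cong (nsmul (suc k)) (coeff-mul p q (suc k))) ⟩
    shift (euler (P ⊛ Q))
      ≈⟨ euler-⊛ P Q ∘ suc ⟩
    (λ k → (euler P ⊛ Q) (suc k) + (P ⊛ euler Q) (suc k))
      ≈⟨ (λ k → cong₂ _+_ (⊛-shiftˡ (euler P) Q refl k) (⊛-shiftʳ P (euler Q) refl k)) ⟩
    (λ k → (shift (euler P) ⊛ Q) k + (P ⊛ shift (euler Q)) k)
      ≈⟨ (λ k → cong₂ _+_ (⊛-cong (coeff-deriv p) (λ _ → refl) k) (⊛-cong (λ _ → refl) (coeff-deriv q) k)) ⟨
    (λ k → (coeff (deriv p) ⊛ Q) k + (P ⊛ coeff (deriv q)) k)
      ≈⟨ (λ k → cong₂ _+_ (coeff-mul (deriv p) q k) (coeff-mul p (deriv q) k)) ⟨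
    (λ k → coeff (mul (deriv p) q) k + coeff (mul p (deriv q)) k)
      ≈⟨ coeff-add (mul (deriv p) q) (mul p (deriv q)) ⟨
    coeff (add (mul (deriv p) q) (mul p (deriv q)))
      ∎
    where
    P = coeff p
    Q = coeff q

  module CharacteristicTwo (x+x≡0 : ∀ x → x + x ≡ 0#) where

    deriv-square : ∀ p → deriv (mul p p) ≈ []
    deriv-square p k =
      trans (deriv-mul p p k)
            (trans (coeff-add (mul (deriv p) p) (mul p (deriv p)) k)
                   (trans (cong (_+ coeff (mul p (deriv p)) k) (mul-comm (deriv p) p k)) (x+x≡0 _)))

    deriv-square-mul : ∀ g h → deriv (mul (mul g g) h) ≈ mul (mul g g) (deriv h)
    deriv-square-mul g h k =
      trans (deriv-mul (mul g g) h k)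
            (trans (coeff-add (mul (deriv (mul g g)) h) (mul (mul g g) (deriv h)) k)
                   (trans (cong (_+ coeff (mul (mul g g) (deriv h)) k)
                                (trans (coeff-mul (deriv (mul g g)) h k)
                                       (⊛-zeroˡ (coeff (deriv (mul g g))) (coeff h) (deriv-square g) k)))
                          (+-identityˡ _)))

  record LeadingTerm (p : Poly) (d : ℕ) (a : A) : Set where
    field
      coeff-degree   : coeff p d ≡ a
      nonzero        : a ≢ 0#
      vanishes-above : VanishesAbove (coeff p) d

  open LeadingTerm public

  Constant : Poly → Set
  Constant p = VanishesAbove (coeff p) 0

  leading-unique : ∀ {p q m n a b} → p ≈ q → LeadingTerm p m a → LeadingTerm q n b → m ≡ n × a ≡ b
  leading-unique {m = m} {n} p≈q lp lq with ℕₚ.<-cmp m n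
  ... | tri< m<n _ _ =
    ⊥-elim (nonzero lq (trans (sym (coeff-degree lq)) (trans (sym (p≈q n)) (vanishes-above lp n m<n))))
  ... | tri> _ _ n<m =
    ⊥-elim (nonzero lp (trans (sym (coeff-degree lp)) (trans (p≈q m) (vanishes-above lq m n<m))))
  ... | tri≈ _ refl _ = refl , trans (sym (coeff-degree lp)) (trans (p≈q m) (coeff-degree lq))

  nonconstant-leading-degree≥1 : ∀ {p d a} → LeadingTerm p d a → NonConstant p → 1 ≤ d
  nonconstant-leading-degree≥1 lp (k , 1≤k , pk≢0) =
    ℕₚ.≤-trans 1≤k (ℕₚ.≮⇒≥ (λ d<k → pk≢0 (vanishes-above lp k d<k)))

  leading-degree0 : ∀ {p d a} → Constant p → LeadingTerm p d a → d ≡ 0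
  leading-degree0 {d = zero}  _       _  = refl
  leading-degree0 {d = suc d} p-const lp =
    ⊥-elim (nonzero lp (trans (sym (coeff-degree lp)) (p-const (suc d) (s≤s z≤n))))

  constant-of-degree0 : ∀ {p d a} → LeadingTerm p d a → d ≡ 0 → Constant p
  constant-of-degree0 {p} lp d≡0 = subst (VanishesAbove (coeff p)) d≡0 (vanishes-above lp)

  module IntegralDomain (_≟0 : ∀ x → Dec (x ≡ 0#))
                        (zero-product : ∀ x y → x * y ≡ 0# → x ≡ 0# ⊎ y ≡ 0#) where

    *-nonzero : ∀ {x y} → x ≢ 0# → y ≢ 0# → x * y ≢ 0#
    *-nonzero {x} {y} x≢0 y≢0 xy≡0 = [ x≢0 , y≢0 ]′ (zero-product x y xy≡0)

    zero-or-leading : ∀ p → p ≈ [] ⊎ ∃₂ (LeadingTerm p)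
    zero-or-leading []      = inj₁ (λ _ → refl)
    zero-or-leading (a ∷ p) with zero-or-leading p
    ... | inj₂ (d , b , lp) = inj₂ (suc d , b , record
      { coeff-degree   = coeff-degree lp
      ; nonzero        = nonzero lp
      ; vanishes-above = λ { (suc i) (s≤s d<i) → vanishes-above lp i d<i } })
    ... | inj₁ p≈[] with a ≟0
    ...   | yes a≡0 = inj₁ λ { zero → a≡0 ; (suc k) → p≈[] k }
    ...   | no  a≢0 = inj₂ (0 , a , record
      { coeff-degree = refl ; nonzero = a≢0 ; vanishes-above = λ { (suc i) _ → p≈[] i } })

    mul-leading : ∀ {p q m n a b} → LeadingTerm p m a → LeadingTerm q n b →
                  LeadingTerm (mul p q) (m ℕ.+ n) (a * b)
    mul-leading {p} {q} {m} {n} lp lq = record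
      { coeff-degree   =
          trans (coeff-mul p q (m ℕ.+ n)) (trans (proj₁ top) (cong₂ _*_ (coeff-degree lp) (coeff-degree lq)))
      ; nonzero        = *-nonzero (nonzero lp) (nonzero lq)
      ; vanishes-above = λ k m+n<k → trans (coeff-mul p q k) (proj₂ top k m+n<k) }
      where
      top = ⊛-top (coeff p) (coeff q) m n (vanishes-above lp) (vanishes-above lq)

    scale-leading : ∀ {c p d a} → c ≢ 0# → LeadingTerm p d a → LeadingTerm (scale c p) d (c * a)
    scale-leading {c} {p} {d} c≢0 lp = record
      { coeff-degree   = trans (coeff-scale c p d) (cong (c *_) (coeff-degree lp))
      ; nonzero        = *-nonzero c≢0 (nonzero lp)
      ; vanishes-above = λ k d<k →
          trans (coeff-scale c p k) (trans (cong (c *_) (vanishes-above lp k d<k)) (zeroʳ c)) }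

    mul≈[]⇒≈[]⊎≈[] : ∀ p q → mul p q ≈ [] → p ≈ [] ⊎ q ≈ []
    mul≈[]⇒≈[]⊎≈[] p q pq≈[] with zero-or-leading p | zero-or-leading q
    ... | inj₁ p≈[]         | _                 = inj₁ p≈[]
    ... | inj₂ _            | inj₁ q≈[]         = inj₂ q≈[]
    ... | inj₂ (m , a , lp) | inj₂ (n , b , lq) =
      ⊥-elim (nonzero lpq (trans (sym (coeff-degree lpq)) (pq≈[] (m ℕ.+ n))))
      where lpq = mul-leading lp lq

    factor-of-one-constant : 1# ≢ 0# → ∀ p q → mul p q ≈ one → Constant p
    factor-of-one-constant 1≢0 p q pq≈1 with zero-or-leading p | zero-or-leading q
    ... | inj₁ p≈[]         | _                 = λ k _ → p≈[] k
    ... | inj₂ _            | inj₁ q≈[]         = ⊥-elim (1≢0 (trans (sym (pq≈1 0)) (mul-≈[]ʳ p q q≈[] 0)))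
    ... | inj₂ (m , a , lp) | inj₂ (n , b , lq) =
      constant-of-degree0 lp (ℕₚ.m+n≡0⇒m≡0 m (proj₁ (leading-unique pq≈1 (mul-leading lp lq) one-leading)))
      where
      one-leading : LeadingTerm one 0 1#
      one-leading = record { coeff-degree = refl ; nonzero = 1≢0 ; vanishes-above = λ { (suc i) _ → refl } }

    square-constant⇒constant : ∀ g → Constant (mul g g) → Constant g
    square-constant⇒constant g gg-const with zero-or-leading g
    ... | inj₁ g≈[]         = λ k _ → g≈[] k
    ... | inj₂ (d , a , lg) =
      constant-of-degree0 lg (ℕₚ.m+n≡0⇒m≡0 d (leading-degree0 gg-const (mul-leading lg lg)))

    square-factor-of-unit-derivative : (∀ x → x + x ≡ 0#) → 1# ≢ 0# →
      ∀ f g h → deriv f ≈ one → f ≈ mul (mul g g) h → Constant g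
    square-factor-of-unit-derivative x+x≡0 1≢0 f g h f′≈1 f≈g²h =
      square-constant⇒constant g (factor-of-one-constant 1≢0 (mul g g) (deriv h) g²h′≈1)
      where
      g²h′≈1 : mul (mul g g) (deriv h) ≈ one
      g²h′≈1 = begin
        coeff (mul (mul g g) (deriv h)) ≈⟨ CharacteristicTwo.deriv-square-mul x+x≡0 g h ⟨
        coeff (deriv (mul (mul g g) h)) ≈⟨ deriv-cong f (mul (mul g g) h) f≈g²h ⟨
        coeff (deriv f)                 ≈⟨ f′≈1 ⟩
        coeff one                       ∎

module PolyMap {A B : Set} {0a 1a : A} {+a *a : A → A → A} {0b 1b : B} {+b *b : B → B → B}
  (isA : IsCommutativeSemiring _≡_ +a *a 0a 1a) (isB : IsCommutativeSemiring _≡_ +b *b 0b 1b)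
  (φ : A → B) (φ-0 : φ 0a ≡ 0b)
  (φ-+ : ∀ x y → φ (+a x y) ≡ +b (φ x) (φ y)) (φ-* : ∀ x y → φ (*a x y) ≡ *b (φ x) (φ y)) where

  private
    module Dom = PolyProperties isA
    module Cod = PolyProperties isB
    module A[t] = PolyOps 0a 1a +a *a
    module B[t] = PolyOps 0b 1b +b *b

  coeff-map : ∀ p → B[t].coeff (map φ p) ≗ φ ∘ A[t].coeff p
  coeff-map []      k       = sym φ-0
  coeff-map (a ∷ p) zero    = refl
  coeff-map (a ∷ p) (suc k) = coeff-map p k

  map-⊛ : ∀ f g → φ ∘ (f Dom.⊛ g) ≗ (φ ∘ f) Cod.⊛ (φ ∘ g)
  map-⊛ f g zero    = φ-* (f 0) (g 0)
  map-⊛ f g (suc k) = trans (φ-+ _ _) (cong₂ +b (φ-* (f 0) (g (suc k))) (map-⊛ (Dom.shift f) g k))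

  map-add : ∀ p q → map φ (A[t].add p q) B[t].≈ B[t].add (map φ p) (map φ q)
  map-add p q k =
    trans (coeff-map (A[t].add p q) k)
          (trans (trans (cong φ (Dom.coeff-add p q k)) (φ-+ _ _))
                 (sym (trans (Cod.coeff-add (map φ p) (map φ q) k) (cong₂ +b (coeff-map p k) (coeff-map q k)))))

  map-scale : ∀ a p → map φ (Dom.scale a p) B[t].≈ Cod.scale (φ a) (map φ p)
  map-scale a p k =
    trans (coeff-map (Dom.scale a p) k)
          (trans (trans (cong φ (Dom.coeff-scale a p k)) (φ-* _ _))
                 (sym (trans (Cod.coeff-scale (φ a) (map φ p) k) (cong (*b (φ a)) (coeff-map p k)))))

  map-mul : ∀ p q → map φ (A[t].mul p q) B[t].≈ B[t].mul (map φ p) (map φ q)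
  map-mul p q k =
    trans (coeff-map (A[t].mul p q) k)
          (trans (cong φ (Dom.coeff-mul p q k))
                 (trans (map-⊛ (A[t].coeff p) (A[t].coeff q) k)
                        (sym (trans (Cod.coeff-mul (map φ p) (map φ q) k)
                                    (Cod.⊛-cong (coeff-map p) (coeff-map q) k)))))

  map-square-mul : ∀ g h →
    map φ (A[t].mul (A[t].mul g g) h) B[t].≈ B[t].mul (B[t].mul (map φ g) (map φ g)) (map φ h)
  map-square-mul g h k =
    trans (map-mul (A[t].mul g g) h k)
          (trans (Cod.coeff-mul (map φ (A[t].mul g g)) (map φ h) k)
                 (trans (Cod.⊛-cong (map-mul g g) (λ _ → refl) k)
                        (sym (Cod.coeff-mul (B[t].mul (map φ g) (map φ g)) (map φ h) k))))

  map-injective : (∀ x y → φ x ≡ φ y → x ≡ y) → ∀ p q → map φ p B[t].≈ map φ q → p A[t].≈ q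
  map-injective φ-injective p q φp≈φq k =
    φ-injective _ _ (trans (sym (coeff-map p k)) (trans (φp≈φq k) (coeff-map q k)))

parity : ℕ → Bool
parity zero    = false
parity (suc n) = not (parity n)

%2≡ᵇ1≡parity : ∀ n → ((n % 2) ℕ.≡ᵇ 1) ≡ parity n
%2≡ᵇ1≡parity zero          = refl
%2≡ᵇ1≡parity (suc zero)    = refl
%2≡ᵇ1≡parity (suc (suc n)) =
  trans (cong (λ r → r ℕ.≡ᵇ 1) (trans (cong (_% 2) (ℕₚ.+-comm 2 n)) ([m+n]%n≡m%n n 2)))
        (trans (%2≡ᵇ1≡parity n) (sym (not-involutive (parity n))))

parity-+ : ∀ m n → parity (m ℕ.+ n) ≡ parity m xor parity n
parity-+ zero    n = refl
parity-+ (suc m) n = trans (cong not (parity-+ m n)) (not-distribˡ-xor (parity m) (parity n))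

parity-* : ∀ m n → parity (m ℕ.* n) ≡ parity m ∧ parity n
parity-* zero    n = refl
parity-* (suc m) n =
  trans (parity-+ n (m ℕ.* n)) (trans (cong (parity n xor_) (parity-* m n)) (xor-∧ (parity m) (parity n)))
  where
  xor-∧ : ∀ x y → y xor (x ∧ y) ≡ not x ∧ y
  xor-∧ true  y     = xor-same y
  xor-∧ false true  = refl
  xor-∧ false false = refl

parity-⊖ : ∀ m n → parity ℤ.∣ m ℤ.⊖ n ∣ ≡ parity m xor parity n
parity-⊖ m       zero    = sym (xor-identityʳ (parity m))
parity-⊖ zero    (suc n) = refl
parity-⊖ (suc m) (suc n) =
  trans (cong (parity ∘ ℤ.∣_∣) (ℤₚ.[1+m]⊖[1+n]≡m⊖n m n))
        (trans (parity-⊖ m n) (sym (xor-annihilates-not (parity m) (parity n))))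

parity-∣+∣ : ∀ a b → parity ℤ.∣ a ℤ.+ b ∣ ≡ parity ℤ.∣ a ∣ xor parity ℤ.∣ b ∣
parity-∣+∣ (+ m)    (+ n)    = parity-+ m n
parity-∣+∣ (+ m)    -[1+ n ] = parity-⊖ m (suc n)
parity-∣+∣ -[1+ m ] (+ n)    = trans (parity-⊖ n (suc m)) (xor-comm (parity n) (parity (suc m)))
parity-∣+∣ -[1+ m ] -[1+ n ] =
  trans (not-involutive _) (trans (parity-+ m n) (sym (xor-annihilates-not (parity m) (parity n))))

red2≡parity : ∀ a → red2 a ≡ parity ℤ.∣ a ∣
red2≡parity a = %2≡ᵇ1≡parity ℤ.∣ a ∣

red2-+ : ∀ a b → red2 (a ℤ.+ b) ≡ red2 a xor red2 b
red2-+ a b =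
  trans (red2≡parity (a ℤ.+ b)) (trans (parity-∣+∣ a b) (sym (cong₂ _xor_ (red2≡parity a) (red2≡parity b))))

red2-* : ∀ a b → red2 (a ℤ.* b) ≡ red2 a ∧ red2 b
red2-* a b =
  trans (red2≡parity (a ℤ.* b))
        (trans (cong parity (ℤₚ.abs-* a b))
               (trans (parity-* ℤ.∣ a ∣ ℤ.∣ b ∣) (sym (cong₂ _∧_ (red2≡parity a) (red2≡parity b)))))

red2≡false⇒2∣ : ∀ a → red2 a ≡ false → + 2 ∣ℤ a
red2≡false⇒2∣ a a-even = m%n≡0⇒n∣m ℤ.∣ a ∣ 2 (remainder0 (ℤ.∣ a ∣ % 2) (m%n<n ℤ.∣ a ∣ 2) a-even)
  where
  remainder0 : ∀ r → r < 2 → (r ℕ.≡ᵇ 1) ≡ false → r ≡ 0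
  remainder0 zero                _                   _  = refl
  remainder0 (suc zero)          _                   ()
  remainder0 (suc (suc _))       (s≤s (s≤s ()))      _

odd⇒red2≡true : ∀ a → Odd a → red2 a ≡ true
odd⇒red2≡true a a-odd with red2 a in a-parity
... | true  = refl
... | false = ⊥-elim (a-odd (red2≡false⇒2∣ a a-parity))

toℚ : ℤ → ℚ
toℚ i = i ℚ./ 1

toℚᵘ-toℚ : ∀ i → ℚ.toℚᵘ (toℚ i) ℚᵘ.≃ mkℚᵘ i 0
toℚᵘ-toℚ i = ℚₚ.toℚᵘ-fromℚᵘ (mkℚᵘ i 0)

toℚ-* : ∀ i j → toℚ (i ℤ.* j) ≡ toℚ i ℚ.* toℚ j
toℚ-* i j = ℚₚ.toℚᵘ-injective (ℚᵘₚ.≃-trans (toℚᵘ-toℚ (i ℤ.* j))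
  (ℚᵘₚ.≃-sym (ℚᵘₚ.≃-trans (ℚₚ.toℚᵘ-homo-* (toℚ i) (toℚ j)) (ℚᵘₚ.*-cong (toℚᵘ-toℚ i) (toℚᵘ-toℚ j)))))

toℚ-+ : ∀ i j → toℚ (i ℤ.+ j) ≡ toℚ i ℚ.+ toℚ j
toℚ-+ i j = ℚₚ.toℚᵘ-injective (ℚᵘₚ.≃-trans (toℚᵘ-toℚ (i ℤ.+ j))
  (ℚᵘₚ.≃-sym (ℚᵘₚ.≃-trans (ℚₚ.toℚᵘ-homo-+ (toℚ i) (toℚ j))
    (ℚᵘₚ.≃-trans (ℚᵘₚ.+-cong (toℚᵘ-toℚ i) (toℚᵘ-toℚ j)) (*≡* (sum-over-1 i j))))))
  where
  sum-over-1 : ∀ i j → (i ℤ.* + 1 ℤ.+ j ℤ.* + 1) ℤ.* + 1 ≡ (i ℤ.+ j) ℤ.* + 1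
  sum-over-1 = solve-∀

toℚ-injective : ∀ i j → toℚ i ≡ toℚ j → i ≡ j
toℚ-injective i j eq with ℚᵘₚ.≃-trans (ℚᵘₚ.≃-sym (toℚᵘ-toℚ i)) (ℚᵘₚ.≃-trans (ℚₚ.toℚᵘ-cong eq) (toℚᵘ-toℚ j))
... | *≡* i*1≡j*1 = trans (sym (ℤₚ.*-identityʳ i)) (trans i*1≡j*1 (ℤₚ.*-identityʳ j))

toℚ-↧*≡↥ : ∀ q → toℚ (↧ q) ℚ.* q ≡ toℚ (↥ q)
toℚ-↧*≡↥ q@(mkℚ n d _) = ℚₚ.toℚᵘ-injective (ℚᵘₚ.≃-trans (ℚₚ.toℚᵘ-homo-* (toℚ (↧ q)) q)
  (ℚᵘₚ.≃-trans (ℚᵘₚ.*-cong (toℚᵘ-toℚ (↧ q)) ℚᵘₚ.≃-refl)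
               (ℚᵘₚ.≃-sym (ℚᵘₚ.≃-trans (toℚᵘ-toℚ (↥ q)) (*≡* (cross n d))))))
  where
  cross : ∀ n d → n ℤ.* + suc (d ℕ.+ 0) ≡ (+ suc d ℤ.* n) ℤ.* + 1
  cross n d rewrite ℕₚ.+-identityʳ d = trans (ℤₚ.*-comm n (+ suc d)) (sym (ℤₚ.*-identityʳ _))

ℚ-zero-product : ∀ p q → p ℚ.* q ≡ ℚ.0ℚ → p ≡ ℚ.0ℚ ⊎ q ≡ ℚ.0ℚ
ℚ-zero-product p@record{} q@record{} pq≡0
  with ℚᵘₚ.≃-trans (ℚᵘₚ.≃-sym (ℚₚ.toℚᵘ-homo-* p q)) (ℚₚ.toℚᵘ-cong pq≡0)
... | *≡* ↥p↥q*1≡0 = Sum.map (ℚₚ.↥p≡0⇒p≡0 p) (ℚₚ.↥p≡0⇒p≡0 q)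
                            (ℤₚ.i*j≡0⇒i≡0∨j≡0 (↥ p) (trans (sym (ℤₚ.*-identityʳ _)) ↥p↥q*1≡0))

𝔽₂-isCommutativeSemiring : IsCommutativeSemiring _≡_ _xor_ _∧_ false true
𝔽₂-isCommutativeSemiring = CommutativeRing.isCommutativeSemiring xor-∧-commutativeRing

∧≡false : ∀ x y → x ∧ y ≡ false → x ≡ false ⊎ y ≡ false
∧≡false false y     _ = inj₁ refl
∧≡false true  false _ = inj₂ refl

module ℤ[t]ₚ = PolyProperties ℤₚ.+-*-isCommutativeSemiring
module ℚ[t]ₚ = PolyProperties (IsCommutativeRing.isCommutativeSemiring ℚₚ.+-*-isCommutativeRing)
module 𝔽₂[t]ₚ = PolyProperties 𝔽₂-isCommutativeSemiring
module ℤ[t]-domain = ℤ[t]ₚ.IntegralDomain (ℤ._≟ + 0) (λ x y → ℤₚ.i*j≡0⇒i≡0∨j≡0 x)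
module 𝔽₂[t]-domain = 𝔽₂[t]ₚ.IntegralDomain (Bool._≟ false) ∧≡false
module Reduction = PolyMap ℤₚ.+-*-isCommutativeSemiring 𝔽₂-isCommutativeSemiring red2 refl red2-+ red2-*
module Embedding = PolyMap ℤₚ.+-*-isCommutativeSemiring
  (IsCommutativeRing.isCommutativeSemiring ℚₚ.+-*-isCommutativeRing) toℚ refl toℚ-+ toℚ-*

bar≈[]⇒halvable : ∀ P → bar P 𝔽₂[t].≈ [] → ∃ λ Q → P ℤ[t].≈ ℤ[t]ₚ.scale (+ 2) Q
bar≈[]⇒halvable []      _      = [] , λ _ → refl
bar≈[]⇒halvable (a ∷ P) P̄≈[]
  with bar≈[]⇒halvable P (P̄≈[] ∘ suc) | ∣ᵤ⇒∣ {+ 2} {a} (red2≡false⇒2∣ a (P̄≈[] 0))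
... | Q , P≈2Q | divides q a≡q*2 = q ∷ Q , λ { zero → trans a≡q*2 (ℤₚ.*-comm q (+ 2)) ; (suc k) → P≈2Q k }

clear-denominators : ∀ p → ∃₂ λ P c → c ≢ + 0 × toℚ[t] P ℚ[t].≈ ℚ[t]ₚ.scale (toℚ c) p
clear-denominators []      = [] , + 1 , (λ ()) , λ _ → refl
clear-denominators (q ∷ p) with clear-denominators p
... | P , c , c≢0 , P≈cp =
  ↥ q ℤ.* c ∷ ℤ[t]ₚ.scale (↧ q) P , ↧ q ℤ.* c , ℤ[t]-domain.*-nonzero {↧ q} (λ ()) c≢0 , λ
    { zero    → begin
        toℚ (↥ q ℤ.* c)               ≡⟨ toℚ-* (↥ q) c ⟩
        toℚ (↥ q) ℚ.* ĉ               ≡⟨ cong (ℚ._* ĉ) (toℚ-↧*≡↥ q) ⟨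
        (toℚ (↧ q) ℚ.* q) ℚ.* ĉ       ≡⟨ xy∙z≈xz∙y (toℚ (↧ q)) q ĉ ⟩
        (toℚ (↧ q) ℚ.* ĉ) ℚ.* q       ≡⟨ cong (ℚ._* q) (toℚ-* (↧ q) c) ⟨
        toℚ (↧ q ℤ.* c) ℚ.* q         ∎
    ; (suc k) → begin
        toℚ[t] (ℤ[t]ₚ.scale (↧ q) P) ! k        ≡⟨ Embedding.map-scale (↧ q) P k ⟩
        ℚ[t]ₚ.scale (toℚ (↧ q)) (toℚ[t] P) ! k  ≡⟨ ℚ[t]ₚ.coeff-scale (toℚ (↧ q)) (toℚ[t] P) k ⟩
        toℚ (↧ q) ℚ.* (toℚ[t] P ! k)            ≡⟨ cong (toℚ (↧ q) ℚ.*_) (trans (P≈cp k) (ℚ[t]ₚ.coeff-scale ĉ p k)) ⟩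
        toℚ (↧ q) ℚ.* (ĉ ℚ.* (p ! k))           ≡⟨ ℚₚ.*-assoc (toℚ (↧ q)) ĉ (p ! k) ⟨
        (toℚ (↧ q) ℚ.* ĉ) ℚ.* (p ! k)           ≡⟨ cong (ℚ._* (p ! k)) (toℚ-* (↧ q) c) ⟨
        toℚ (↧ q ℤ.* c) ℚ.* (p ! k)             ≡⟨ ℚ[t]ₚ.coeff-scale (toℚ (↧ q ℤ.* c)) p k ⟨
        ℚ[t]ₚ.scale (toℚ (↧ q ℤ.* c)) p ! k     ∎ }
  where
  open ≡-Reasoning
  open import Algebra.Properties.CommutativeSemigroup
    (CommutativeMonoid.commutativeSemigroup ℚₚ.*-1-commutativeMonoid) using (xy∙z≈xz∙y)
  ĉ = toℚ c
  _!_ = ℚ[t].coeff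

SquareFactorisation : ℤ[t].Poly → ℤ → Set
SquareFactorisation f N =
  ∃₂ λ G H → ℤ[t].NonConstant G × ℤ[t]ₚ.scale N f ℤ[t].≈ ℤ[t].mul (ℤ[t].mul G G) H

integral-square-factorisation : ∀ f g h → ℚ[t].NonConstant g →
  toℚ[t] f ℚ[t].≈ ℚ[t].mul (ℚ[t].mul g g) h → ∃ λ N → N ≢ + 0 × SquareFactorisation f N
integral-square-factorisation f g h (k , 1≤k , gk≢0) f≈g²h
  with clear-denominators g | clear-denominators h
... | G , a , a≢0 , G≈ag | H , b , b≢0 , H≈bh =
    N , *-nonzero (*-nonzero a≢0 a≢0) b≢0
  , G , H , (k , 1≤k , Gk≢0) , Embedding.map-injective toℚ-injective (scale N f) (mul (mul G G) H) N̂f≈Ĝ²Ĥ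
  where
  open ℤ[t]-domain using (*-nonzero)
  open ℤ[t]ₚ using (scale)
  open ℤ[t] using (mul)
  open import Relation.Binary.Reasoning.Setoid (ℕ →-setoid ℚ)
  N = (a ℤ.* a) ℤ.* b
  â = toℚ a
  b̂ = toℚ b
  g²h = ℚ[t].mul (ℚ[t].mul g g) h

  Gk≢0 : ℤ[t].coeff G k ≢ + 0
  Gk≢0 Gk≡0 with ℚ-zero-product â (ℚ[t].coeff g k)
    (trans (sym (ℚ[t]ₚ.coeff-scale â g k))
           (trans (sym (G≈ag k)) (trans (Embedding.coeff-map G k) (cong toℚ Gk≡0))))
  ... | inj₁ â≡0  = a≢0 (toℚ-injective a (+ 0) â≡0)
  ... | inj₂ gk≡0 = gk≢0 gk≡0

  N̂f≈Ĝ²Ĥ : toℚ[t] (scale N f) ℚ[t].≈ toℚ[t] (mul (mul G G) H)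
  N̂f≈Ĝ²Ĥ = begin
    ℚ[t].coeff (toℚ[t] (scale N f))
      ≈⟨ Embedding.map-scale N f ⟩
    ℚ[t].coeff (ℚ[t]ₚ.scale (toℚ N) (toℚ[t] f))
      ≈⟨ ℚ[t]ₚ.scale-cong (toℚ N) (toℚ[t] f) g²h f≈g²h ⟩
    ℚ[t].coeff (ℚ[t]ₚ.scale (toℚ N) g²h)
      ≡⟨ cong (λ x → ℚ[t].coeff (ℚ[t]ₚ.scale x g²h)) (trans (toℚ-* (a ℤ.* a) b) (cong (ℚ._* b̂) (toℚ-* a a))) ⟩
    ℚ[t].coeff (ℚ[t]ₚ.scale ((â ℚ.* â) ℚ.* b̂) g²h)
      ≈⟨ ℚ[t]ₚ.scale-scale (â ℚ.* â) b̂ g²h ⟨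
    ℚ[t].coeff (ℚ[t]ₚ.scale (â ℚ.* â) (ℚ[t]ₚ.scale b̂ g²h))
      ≈⟨ ℚ[t]ₚ.scale-cong (â ℚ.* â) (ℚ[t].mul (ℚ[t].mul g g) (ℚ[t]ₚ.scale b̂ h)) (ℚ[t]ₚ.scale b̂ g²h)
            (ℚ[t]ₚ.scale-mulʳ b̂ (ℚ[t].mul g g) h) ⟨
    ℚ[t].coeff (ℚ[t]ₚ.scale (â ℚ.* â) (ℚ[t].mul (ℚ[t].mul g g) (ℚ[t]ₚ.scale b̂ h)))
      ≈⟨ ℚ[t]ₚ.square-scale â g (ℚ[t]ₚ.scale b̂ h) ⟨
    ℚ[t].coeff (ℚ[t].mul (ℚ[t].mul (ℚ[t]ₚ.scale â g) (ℚ[t]ₚ.scale â g)) (ℚ[t]ₚ.scale b̂ h))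
      ≈⟨ ℚ[t]ₚ.square-mul-cong (toℚ[t] G) (ℚ[t]ₚ.scale â g) (toℚ[t] H) (ℚ[t]ₚ.scale b̂ h) G≈ag H≈bh ⟨
    ℚ[t].coeff (ℚ[t].mul (ℚ[t].mul (toℚ[t] G) (toℚ[t] G)) (toℚ[t] H))
      ≈⟨ Embedding.map-square-mul G H ⟨
    ℚ[t].coeff (toℚ[t] (mul (mul G G) H))
      ∎

reduce-square-factorisation : ∀ f N G H → ℤ[t]ₚ.scale N f ℤ[t].≈ ℤ[t].mul (ℤ[t].mul G G) H →
  𝔽₂[t]ₚ.scale (red2 N) (bar f) 𝔽₂[t].≈ 𝔽₂[t].mul (𝔽₂[t].mul (bar G) (bar G)) (bar H)
reduce-square-factorisation f N G H Nf≈G²H k =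
  trans (sym (Reduction.map-scale N f k))
        (trans (Reduction.coeff-map (ℤ[t]ₚ.scale N f) k)
               (trans (cong red2 (Nf≈G²H k))
                      (trans (sym (Reduction.coeff-map (ℤ[t].mul (ℤ[t].mul G G) H) k))
                             (Reduction.map-square-mul G H k))))

scale2-injective : ∀ p q → ℤ[t]ₚ.scale (+ 2) p ℤ[t].≈ ℤ[t]ₚ.scale (+ 2) q → p ℤ[t].≈ q
scale2-injective p q 2p≈2q k =
  ℤₚ.*-cancelˡ-≡ (+ 2) _ _
    (trans (sym (ℤ[t]ₚ.coeff-scale (+ 2) p k)) (trans (2p≈2q k) (ℤ[t]ₚ.coeff-scale (+ 2) q k)))

halve-square-factorisation : ∀ f N → SquareFactorisation f (+ 2 ℤ.* N) → SquareFactorisation f N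
halve-square-factorisation f N (G , H , G-nonconst@(k , 1≤k , Gk≢0) , 2Nf≈G²H) =
  halve ([ inj₁ ∘ [ id , id ]′ ∘ 𝔽₂[t]-domain.mul≈[]⇒≈[]⊎≈[] (bar G) (bar G) , inj₂ ]′
           (𝔽₂[t]-domain.mul≈[]⇒≈[]⊎≈[] (𝔽₂[t].mul (bar G) (bar G)) (bar H) Ḡ²H̄≈[]))
  where
  open ℤ[t]ₚ using (scale; scale-scale; scale-cong; scale-mulʳ; square-scale; square-mul-cong; coeff-scale)
  open ℤ[t] using (mul)
  open import Relation.Binary.Reasoning.Setoid (ℕ →-setoid ℤ)

  Ḡ²H̄≈[] : 𝔽₂[t].mul (𝔽₂[t].mul (bar G) (bar G)) (bar H) 𝔽₂[t].≈ []
  Ḡ²H̄≈[] k =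
    trans (sym (reduce-square-factorisation f (+ 2 ℤ.* N) G H 2Nf≈G²H k))
          (trans (𝔽₂[t]ₚ.coeff-scale (red2 (+ 2 ℤ.* N)) (bar f) k)
                 (cong (_∧ 𝔽₂[t].coeff (bar f) k) (red2-* (+ 2) N)))

  2Nf≈G²H′ : scale (+ 2) (scale N f) ℤ[t].≈ mul (mul G G) H
  2Nf≈G²H′ k = trans (scale-scale (+ 2) N f k) (2Nf≈G²H k)

  halve : bar G 𝔽₂[t].≈ [] ⊎ bar H 𝔽₂[t].≈ [] → SquareFactorisation f N
  halve (inj₁ Ḡ≈[]) with bar≈[]⇒halvable G Ḡ≈[]
  ... | G′ , G≈2G′ = G′ , scale (+ 2) H , G′-nonconst , scale2-injective (scale N f) G′²2H (begin
      ℤ[t].coeff (scale (+ 2) (scale N f))          ≈⟨ 2Nf≈G²H′ ⟩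
      ℤ[t].coeff (mul (mul G G) H)                  ≈⟨ square-mul-cong G 2G′ H H G≈2G′ (λ _ → refl) ⟩
      ℤ[t].coeff (mul (mul 2G′ 2G′) H)              ≈⟨ square-scale (+ 2) G′ H ⟩
      ℤ[t].coeff (scale (+ 4) G′²H)                 ≈⟨ scale-scale (+ 2) (+ 2) G′²H ⟨
      ℤ[t].coeff (scale (+ 2) (scale (+ 2) G′²H))   ≈⟨ scale-cong (+ 2) G′²2H (scale (+ 2) G′²H)
                                                                  (scale-mulʳ (+ 2) (mul G′ G′) H) ⟨
      ℤ[t].coeff (scale (+ 2) G′²2H)                ∎)
    where
    2G′ = scale (+ 2) G′
    G′²H = mul (mul G′ G′) H
    G′²2H = mul (mul G′ G′) (scale (+ 2) H)
    G′-nonconst : ℤ[t].NonConstant G′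
    G′-nonconst =
      k , 1≤k , λ G′k≡0 → Gk≢0 (trans (G≈2G′ k) (trans (coeff-scale (+ 2) G′ k) (cong (+ 2 ℤ.*_) G′k≡0)))
  halve (inj₂ H̄≈[]) with bar≈[]⇒halvable H H̄≈[]
  ... | H′ , H≈2H′ = G , H′ , G-nonconst , scale2-injective (scale N f) (mul (mul G G) H′) (begin
      ℤ[t].coeff (scale (+ 2) (scale N f))                 ≈⟨ 2Nf≈G²H′ ⟩
      ℤ[t].coeff (mul (mul G G) H)                         ≈⟨ square-mul-cong G G H (scale (+ 2) H′) (λ _ → refl) H≈2H′ ⟩
      ℤ[t].coeff (mul (mul G G) (scale (+ 2) H′))          ≈⟨ scale-mulʳ (+ 2) (mul G G) H′ ⟩
      ℤ[t].coeff (scale (+ 2) (mul (mul G G) H′))          ∎)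

halve-bound : ∀ q M → ℤ.∣ q ℤ.* + 2 ∣ ≤ suc M → q ≢ + 0 → ℤ.∣ q ∣ ≤ M
halve-bound q M ∣2q∣≤1+M q≢0 =
  ℕₚ.≤-pred (ℕₚ.<-≤-trans (ℕₚ.m<m*n ℤ.∣ q ∣ 2 (s≤s (s≤s z≤n)))
                          (subst (_≤ suc M) (ℤₚ.abs-* q (+ 2)) ∣2q∣≤1+M))
  where instance _ = ℕ.≢-nonZero (q≢0 ∘ ℤₚ.∣i∣≡0⇒i≡0)

odd-square-factorisation : ∀ f N → N ≢ + 0 → SquareFactorisation f N →
  ∃ λ N′ → red2 N′ ≡ true × SquareFactorisation f N′
odd-square-factorisation f N = descend ℤ.∣ N ∣ N ℕₚ.≤-refl
  where
  descend : ∀ M K → ℤ.∣ K ∣ ≤ M → K ≢ + 0 → SquareFactorisation f K →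
            ∃ λ N′ → red2 N′ ≡ true × SquareFactorisation f N′
  descend zero    K ∣K∣≤0   K≢0 _ = ⊥-elim (K≢0 (ℤₚ.∣i∣≡0⇒i≡0 (ℕₚ.n≤0⇒n≡0 ∣K∣≤0)))
  descend (suc M) K ∣K∣≤1+M K≢0 Kf≈G²H with red2 K in K-parity
  ... | true  = K , K-parity , Kf≈G²H
  ... | false with ∣ᵤ⇒∣ {+ 2} {K} (red2≡false⇒2∣ K K-parity)
  ...   | divides q refl =
    descend M q (halve-bound q M ∣K∣≤1+M q≢0) q≢0
            (halve-square-factorisation f q (subst (SquareFactorisation f) (ℤₚ.*-comm q (+ 2)) Kf≈G²H))
    where
    q≢0 : q ≢ + 0
    q≢0 q≡0 = K≢0 (cong (ℤ._* + 2) q≡0)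

deriv-bar-square-add : ∀ z c →
  𝔽₂[t].deriv (bar (ℤ[t].add (ℤ[t].mul z z) c)) 𝔽₂[t].≈ 𝔽₂[t].deriv (bar c)
deriv-bar-square-add z c = begin
  coeff (deriv (bar f))                             ≈⟨ deriv-cong (bar f) (add (mul z̄ z̄) c̄) f̄≈z̄²+c̄ ⟩
  coeff (deriv (add (mul z̄ z̄) c̄))                 ≈⟨ deriv-add (mul z̄ z̄) c̄ ⟩
  coeff (add (deriv (mul z̄ z̄)) (deriv c̄))         ≈⟨ add-congˡ (deriv (mul z̄ z̄)) [] (deriv c̄) (deriv-square z̄) ⟩
  coeff (deriv c̄)                                   ∎
  where
  open 𝔽₂[t]
  open 𝔽₂[t]ₚ using (deriv-cong; deriv-add; add-congˡ)
  open 𝔽₂[t]ₚ.CharacteristicTwo xor-same using (deriv-square)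
  open import Relation.Binary.Reasoning.Setoid (ℕ →-setoid Bool)
  f = ℤ[t].add (ℤ[t].mul z z) c
  z̄ = bar z
  c̄ = bar c
  f̄≈z̄²+c̄ : bar f ≈ add (mul z̄ z̄) c̄
  f̄≈z̄²+c̄ k = trans (Reduction.map-add (ℤ[t].mul z z) c k)
                    (add-congˡ (bar (ℤ[t].mul z z)) (mul z̄ z̄) c̄ (Reduction.map-mul z z) k)

square-factor-higher-coeffs-even : ∀ f N G H → 𝔽₂[t].deriv (bar f) 𝔽₂[t].≈ 𝔽₂[t].one → red2 N ≡ true →
  ℤ[t]ₚ.scale N f ℤ[t].≈ ℤ[t].mul (ℤ[t].mul G G) H → ∀ k → 1 ≤ k → red2 (ℤ[t].coeff G k) ≡ false
square-factor-higher-coeffs-even f N G H f̄′≈1 N-odd Nf≈G²H k 1≤k =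
  trans (sym (Reduction.coeff-map G k))
        (𝔽₂[t]-domain.square-factor-of-unit-derivative xor-same (λ ()) (bar f) (bar G) (bar H) f̄′≈1 f̄≈Ḡ²H̄
                                                       k 1≤k)
  where
  f̄≈Ḡ²H̄ : bar f 𝔽₂[t].≈ 𝔽₂[t].mul (𝔽₂[t].mul (bar G) (bar G)) (bar H)
  f̄≈Ḡ²H̄ j =
    trans (sym (𝔽₂[t]ₚ.coeff-scale true (bar f) j))
          (trans (cong (λ b → 𝔽₂[t].coeff (𝔽₂[t]ₚ.scale b (bar f)) j) (sym N-odd))
                 (reduce-square-factorisation f N G H Nf≈G²H j))

red2≡true⇒≢0 : ∀ {N} → red2 N ≡ true → N ≢ + 0
red2≡true⇒≢0 N-odd refl = contradiction N-odd λ ()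

odd-leading-coeff⇒¬even-square-factor : ∀ {f n a} N G H → ℤ[t]ₚ.LeadingTerm f n a →
  red2 a ≡ true → red2 N ≡ true → ℤ[t].NonConstant G → (∀ k → 1 ≤ k → red2 (ℤ[t].coeff G k) ≡ false) →
  ¬ (ℤ[t]ₚ.scale N f ℤ[t].≈ ℤ[t].mul (ℤ[t].mul G G) H)
odd-leading-coeff⇒¬even-square-factor {f} {n} {a} N G H lf a-odd N-odd G-nonconst G-even Nf≈G²H =
  by-leading-terms (zero-or-leading G) (zero-or-leading H)
  where
  open ℤ[t]ₚ
    using (LeadingTerm; nonzero; coeff-degree; leading-unique; nonconstant-leading-degree≥1; mul-≈[]ʳ)
  open ℤ[t]-domain using (zero-or-leading; scale-leading; mul-leading)

  lNf : LeadingTerm (ℤ[t]ₚ.scale N f) n (N ℤ.* a)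
  lNf = scale-leading {N} (red2≡true⇒≢0 N-odd) lf

  by-leading-terms : G ℤ[t].≈ [] ⊎ ∃₂ (LeadingTerm G) → H ℤ[t].≈ [] ⊎ ∃₂ (LeadingTerm H) → ⊥
  by-leading-terms (inj₁ G≈[])         _         = proj₂ (proj₂ G-nonconst) (G≈[] (proj₁ G-nonconst))
  by-leading-terms (inj₂ _)            (inj₁ H≈[]) =
    nonzero lNf (trans (sym (coeff-degree lNf)) (trans (Nf≈G²H n) (mul-≈[]ʳ (ℤ[t].mul G G) H H≈[] n)))
  by-leading-terms (inj₂ (d , b , lG)) (inj₂ (e , c , lH)) =
    contradiction (trans (sym red2-Na) (trans (cong red2 Na≡b²c) red2-b²c)) λ ()
    where
    red2-Na : red2 (N ℤ.* a) ≡ true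
    red2-Na = trans (red2-* N a) (cong₂ _∧_ N-odd a-odd)
    Na≡b²c : N ℤ.* a ≡ (b ℤ.* b) ℤ.* c
    Na≡b²c = proj₂ (leading-unique Nf≈G²H lNf (mul-leading (mul-leading lG lG) lH))
    b-even : red2 b ≡ false
    b-even = trans (cong red2 (sym (coeff-degree lG))) (G-even d (nonconstant-leading-degree≥1 lG G-nonconst))
    red2-b²c : red2 ((b ℤ.* b) ℤ.* c) ≡ false
    red2-b²c = trans (red2-* (b ℤ.* b) c) (cong (_∧ red2 c) (trans (red2-* b b) (cong₂ _∧_ b-even b-even)))

lemma5p1 : (z c : ℤ[t].Poly) →
    Σ ℤ (λ a → ℤ[t].IsLeadingCoeff (ℤ[t].add (ℤ[t].mul z z) c) a × Odd a) →
    𝔽₂[t]._≈_ (𝔽₂[t].deriv (bar c)) 𝔽₂[t].one →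
    ℚ[t].SquareFree (toℚ[t] (ℤ[t].add (ℤ[t].mul z z) c))
lemma5p1 z c (a , (n , fn≡a , a≢0 , f>n) , a-odd) c̄′≈1 (g , h , g-nonconst , f≈g²h) =
  let N , N≢0 , Nf≈G²H = integral-square-factorisation f g h g-nonconst f≈g²h
      N′ , N′-odd , G , H , G-nonconst , N′f≈G²H = odd-square-factorisation f N N≢0 Nf≈G²H
      G-even = square-factor-higher-coeffs-even f N′ G H f̄′≈1 N′-odd N′f≈G²H
  in  odd-leading-coeff⇒¬even-square-factor N′ G H f-leading (odd⇒red2≡true a a-odd) N′-odd G-nonconst G-even
        N′f≈G²H
  where
  f = ℤ[t].add (ℤ[t].mul z z) c
  f-leading : ℤ[t]ₚ.LeadingTerm f n a
  f-leading = record { coeff-degree = fn≡a ; nonzero = a≢0 ; vanishes-above = f>n }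
  f̄′≈1 : 𝔽₂[t].deriv (bar f) 𝔽₂[t].≈ 𝔽₂[t].one
  f̄′≈1 k = trans (deriv-bar-square-add z c k) (c̄′≈1 k)
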